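{- Fix a positive integer $\alpha$. Let $F=\{(r_i,s_i)\}_{i=1}^K$ be a finite set of pairs of positive integers, and put \[ M_i:=4\alpha s_ir_i-1,\qquad Q:=\mathrm{lcm}(M_1,\dots,M_K). \] Assume the covering condition: for each $p\in\{0,1,\dots,Q-1\}$ there is an index $i$ with \[ p\equiv-4\alpha s_i^2\pmod{M_i}\qquad\text{and}\qquad A_{r_i,s_i}(p)\in[L(p),U(p)]. \] Then for every odd prime $P$ there exists an index $i$ with \[ M_i\mid (4\alpha s_i^2+P)\qquad\text{and}\qquad A:=A_{r_i,s_i}(P)\in[L(P),U(P)]\subset\Big(\frac P4,\frac{3P}4\Big). \] In particular, $m:=4A-P>0$.
   Context: For positive integers $r,s$ and real $x$, define \[ A_{r,s}(x)=\lambda_{r,s}x+\mu_{r,s},\qquad \lambda_{r,s}=\frac{\alpha sr}{4\alpha sr-1},\qquad \mu_{r,s}=\alpha s\Big(\frac{4\alpha rs^2}{4\alpha sr-1}-s\Big). \] Also define $L(x)=\frac x4+\frac34$ and $U(x)=\frac{3x}4-\frac34$. -}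

module Defs where

open import Data.Nat as ℕ using (ℕ; zero; suc)
open import Data.Nat.LCM using (lcm)
open import Data.Fin using (Fin)
import Data.Fin as Fin
open import Data.Integer as ℤ using (ℤ; +_)
open import Data.Integer.Divisibility as ℤD using ()
open import Data.Rational as ℚ using (ℚ; 0ℚ; _/_; _+_; _*_; _-_; _÷_; ≢-nonZero)
open import Data.Rational.Properties using (_≟_)
open import Relation.Nullary using (yes; no)

⟦_⟧ : ℕ → ℚ
⟦ n ⟧ = + n / 1

-- total division on ℚ (convention: x ÷′ 0 = 0; only ever used with nonzero divisors)
_÷′_ : ℚ → ℚ → ℚ
x ÷′ y with y ≟ 0ℚ
... | yes _ = 0ℚ
... | no y≢0 = _÷_ x y {{≢-nonZero y≢0}}

_≡_[mod_] : ℤ → ℤ → ℕ → Set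
a ≡ b [mod m ] = (+ m) ℤD.∣ (a ℤ.- b)

lam : ℕ → ℕ → ℕ → ℚ
lam α r s = ⟦ α ℕ.* s ℕ.* r ⟧ ÷′ (⟦ 4 ℕ.* α ℕ.* s ℕ.* r ⟧ - ⟦ 1 ⟧)

mu : ℕ → ℕ → ℕ → ℚ
mu α r s = ⟦ α ℕ.* s ⟧ * ((⟦ 4 ℕ.* α ℕ.* r ℕ.* (s ℕ.* s) ⟧ ÷′ (⟦ 4 ℕ.* α ℕ.* s ℕ.* r ⟧ - ⟦ 1 ⟧)) - ⟦ s ⟧)

A : ℕ → ℕ → ℕ → ℚ → ℚ
A α r s x = lam α r s * x + mu α r s

L : ℚ → ℚ
L x = x * (+ 1 / 4) + (+ 3 / 4)

U : ℚ → ℚ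
U x = (+ 3 / 4) * x - (+ 3 / 4)

-- M = 4 α s r - 1   (≥ 3 for positive α, r, s, so truncated subtraction is harmless)
Mod : ℕ → ℕ → ℕ → ℕ
Mod α r s = 4 ℕ.* α ℕ.* s ℕ.* r ℕ.∸ 1

lcmFin : (K : ℕ) → (Fin K → ℕ) → ℕ
lcmFin zero f = 1
lcmFin (suc K) f = lcm (f Fin.zero) (lcmFin K (λ i → f (Fin.suc i)))

{-# OPTIONS --safe #-}
-- Let p = P mod Q and take the index i that the covering condition gives for p. Since
-- M_i ∣ Q ∣ P − p, the congruence p ≡ −4αs_i² (mod M_i) carries over to P. The slope
-- λ = αsr/(4αsr − 1) of A lies in [¼, ¾], between the slopes of L and U, so A − L and
-- U − A are nondecreasing; as p ≤ P, the inequalities L(p) ≤ A(p) ≤ U(p) persist at P.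
-- The remaining strict inequalities only use the shapes of L and U.
module Submission where

open import Defs
open import Data.Nat as ℕ using (ℕ; zero; suc; NonZero)
import Data.Nat.Properties as ℕ
open import Data.Nat.Divisibility using (_∣_; ∣-trans; 0∣⇒≡0; m∣m*n; n∣m*n; ∣m∣n⇒∣m+n)
open import Data.Nat.DivMod using (_%_; m≡m%n+[m/n]*n; m%n<n; m%n≤m)
open import Data.Nat.LCM using (lcm; lcm-least; m∣lcm[m,n]; n∣lcm[m,n])
open import Data.Nat.Primality using (Prime)
import Data.Nat.Coprimality as Coprime
open import Data.Fin using (Fin; zero; suc)
open import Data.Integer as ℤ using (+_)
import Data.Integer.Properties as ℤ
open import Data.Rational as ℚ using (ℚ; mkℚ; 0ℚ; 1ℚ; _≤_; _<_; _+_; _*_; _-_; _/_)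
import Data.Rational.Properties as ℚ
import Data.Rational.Unnormalised as ℚᵘ using (*≡*)
import Data.Rational.Unnormalised.Properties as ℚᵘ
open import Data.Rational.Solver using (module +-*-Solver)
open +-*-Solver using (solve; _:=_; _:+_; _:-_; _:*_; con)
open import Data.Product using (Σ; _×_; _,_)
open import Function using (_∘_)
open import Relation.Binary.PropositionalEquality
open import Relation.Nullary using (¬_; yes; no; contradiction)

n/1 : ℕ → ℚ
n/1 n = mkℚ (+ n) 0 (Coprime.sym (Coprime.1-coprimeTo n))

⟦⟧≡n/1 : ∀ n → ⟦ n ⟧ ≡ n/1 n
⟦⟧≡n/1 n = ℚ.normalize-coprime (Coprime.sym (Coprime.1-coprimeTo n))

⟦⟧-homo-+ : ∀ m n → ⟦ m ℕ.+ n ⟧ ≡ ⟦ m ⟧ + ⟦ n ⟧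
⟦⟧-homo-+ m n rewrite ⟦⟧≡n/1 m | ⟦⟧≡n/1 n | ⟦⟧≡n/1 (m ℕ.+ n) =
  ℚ.toℚᵘ-injective (ℚᵘ.≃-trans (ℚᵘ.*≡* numerators) (ℚᵘ.≃-sym (ℚ.toℚᵘ-homo-+ (n/1 m) (n/1 n))))
  where
  numerators : + (m ℕ.+ n) ℤ.* + 1 ≡ (+ m ℤ.* + 1 ℤ.+ + n ℤ.* + 1) ℤ.* + 1
  numerators rewrite ℤ.*-identityʳ (+ m) | ℤ.*-identityʳ (+ n) | ℤ.*-identityʳ (+ (m ℕ.+ n)) = refl

⟦⟧-homo-* : ∀ m n → ⟦ m ℕ.* n ⟧ ≡ ⟦ m ⟧ * ⟦ n ⟧
⟦⟧-homo-* zero n = sym (ℚ.*-zeroˡ ⟦ n ⟧)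
⟦⟧-homo-* (suc m) n = begin
  ⟦ n ℕ.+ m ℕ.* n ⟧        ≡⟨ ⟦⟧-homo-+ n (m ℕ.* n) ⟩
  ⟦ n ⟧ + ⟦ m ℕ.* n ⟧      ≡⟨ cong (ℚ._+_ ⟦ n ⟧) (⟦⟧-homo-* m n) ⟩
  ⟦ n ⟧ + ⟦ m ⟧ * ⟦ n ⟧    ≡⟨ solve 2 (λ x y → y :+ x :* y := (con 1ℚ :+ x) :* y) refl ⟦ m ⟧ ⟦ n ⟧ ⟩
  (1ℚ + ⟦ m ⟧) * ⟦ n ⟧     ≡⟨ cong (_* ⟦ n ⟧) (⟦⟧-homo-+ 1 m) ⟨
  ⟦ suc m ⟧ * ⟦ n ⟧        ∎
  where open ≡-Reasoning

⟦⟧-mono-≤ : ∀ {m n} → m ℕ.≤ n → ⟦ m ⟧ ≤ ⟦ n ⟧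
⟦⟧-mono-≤ {m} {n} m≤n rewrite ⟦⟧≡n/1 m | ⟦⟧≡n/1 n =
  ℚ.*≤* (subst₂ ℤ._≤_ (sym (ℤ.*-identityʳ (+ m))) (sym (ℤ.*-identityʳ (+ n))) (ℤ.+≤+ m≤n))

p≤q⇒0≤q-p : ∀ {p q} → p ≤ q → 0ℚ ≤ q - p
p≤q⇒0≤q-p {p} {q} p≤q = subst (_≤ q - p) (ℚ.+-inverseʳ p) (ℚ.+-monoˡ-≤ (ℚ.- p) p≤q)

¼ ¾ : ℚ
¼ = + 1 / 4
¾ = + 3 / 4

*-÷′-inverse : ∀ x y → y ≢ 0ℚ → y * (x ÷′ y) ≡ x
*-÷′-inverse x y y≢0 with y ℚ.≟ 0ℚ
... | yes y≡0 = contradiction y≡0 y≢0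
... | no _ = begin
  y * (x * ℚ.1/ y)   ≡⟨ solve 3 (λ x y z → y :* (x :* z) := x :* (y :* z)) refl x y (ℚ.1/ y) ⟩
  x * (y * ℚ.1/ y)   ≡⟨ cong (x *_) (ℚ.*-inverseʳ y) ⟩
  x * 1ℚ             ≡⟨ ℚ.*-identityʳ x ⟩
  x                  ∎
  where
  open ≡-Reasoning
  instance _ = ℚ.≢-nonZero y≢0

≤-÷′ : ∀ {a x y} → 0ℚ < y → y * a ≤ x → a ≤ x ÷′ y
≤-÷′ {a} {x} {y} y>0 ya≤x = ℚ.*-cancelˡ-≤-pos y {{ℚ.positive y>0}}
  (subst (y * a ≤_) (sym (*-÷′-inverse x y (≢-sym (ℚ.<⇒≢ y>0)))) ya≤x)

÷′-≤ : ∀ {a x y} → 0ℚ < y → x ≤ y * a → x ÷′ y ≤ a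
÷′-≤ {a} {x} {y} y>0 x≤ya = ℚ.*-cancelˡ-≤-pos y {{ℚ.positive y>0}}
  (subst (_≤ y * a) (sym (*-÷′-inverse x y (≢-sym (ℚ.<⇒≢ y>0)))) x≤ya)

slope : ℚ → ℚ
slope b = b ÷′ (⟦ 4 ⟧ * b - 1ℚ)

module _ {b : ℚ} (b≥1 : 1ℚ ≤ b) where

  private
    b-1≥0 : 0ℚ ≤ b - 1ℚ
    b-1≥0 = p≤q⇒0≤q-p b≥1

  4b-1>0 : 0ℚ < ⟦ 4 ⟧ * b - 1ℚ
  4b-1>0 = begin-strict
    0ℚ                          <⟨ ℚ.+-mono-≤-< (ℚ.*-monoʳ-≤-nonNeg ⟦ 4 ⟧ b-1≥0) (ℚ.positive⁻¹ ⟦ 3 ⟧) ⟩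
    (b - 1ℚ) * ⟦ 4 ⟧ + ⟦ 3 ⟧    ≡⟨ solve 1 (λ b → (b :- con 1ℚ) :* con ⟦ 4 ⟧ :+ con ⟦ 3 ⟧ := con ⟦ 4 ⟧ :* b :- con 1ℚ) refl b ⟩
    ⟦ 4 ⟧ * b - 1ℚ              ∎
    where open ℚ.≤-Reasoning

  ¼≤slope : ¼ ≤ slope b
  ¼≤slope = ≤-÷′ 4b-1>0 (begin
    (⟦ 4 ⟧ * b - 1ℚ) * ¼    ≡⟨ solve 1 (λ b → (con ⟦ 4 ⟧ :* b :- con 1ℚ) :* con ¼ := b :- con ¼) refl b ⟩
    b - ¼                   ≤⟨ ℚ.+-monoʳ-≤ b (ℚ.≤ᵇ⇒≤ _) ⟩
    b + 0ℚ                  ≡⟨ ℚ.+-identityʳ b ⟩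
    b                       ∎)
    where open ℚ.≤-Reasoning

  slope≤¾ : slope b ≤ ¾
  slope≤¾ = ÷′-≤ 4b-1>0 (begin
    b                                      ≡⟨ ℚ.+-identityʳ b ⟨
    b + 0ℚ                                 ≤⟨ ℚ.+-monoʳ-≤ b 0≤2[b-1]+5/4 ⟩
    b + ((b - 1ℚ) * ⟦ 2 ⟧ + + 5 / 4)       ≡⟨ solve 1 (λ b → b :+ ((b :- con 1ℚ) :* con ⟦ 2 ⟧ :+ con (+ 5 / 4))
                                                         := (con ⟦ 4 ⟧ :* b :- con 1ℚ) :* con ¾) refl b ⟩
    (⟦ 4 ⟧ * b - 1ℚ) * ¾                   ∎)
    where
    open ℚ.≤-Reasoning
    0≤2[b-1]+5/4 : 0ℚ ≤ (b - 1ℚ) * ⟦ 2 ⟧ + + 5 / 4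
    0≤2[b-1]+5/4 = ℚ.+-mono-≤ (ℚ.*-monoʳ-≤-nonNeg ⟦ 2 ⟧ b-1≥0) (ℚ.≤ᵇ⇒≤ {0ℚ} {+ 5 / 4} _)

L≤-propagate : ∀ {l m x y} → ¼ ≤ l → x ≤ y → L x ≤ l * x + m → L y ≤ l * y + m
L≤-propagate {l} {m} {x} {y} ¼≤l x≤y Lx≤ = begin
  L y                                ≡⟨ solve 2 (λ x y → y :* con ¼ :+ con ¾ := (x :* con ¼ :+ con ¾) :+ con ¼ :* (y :- x)) refl x y ⟩
  L x + ¼ * (y - x)                  ≤⟨ ℚ.+-mono-≤ Lx≤ (ℚ.*-monoʳ-≤-nonNeg (y - x) {{ℚ.nonNegative (p≤q⇒0≤q-p x≤y)}} ¼≤l) ⟩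
  (l * x + m) + l * (y - x)          ≡⟨ solve 4 (λ l m x y → (l :* x :+ m) :+ l :* (y :- x) := l :* y :+ m) refl l m x y ⟩
  l * y + m                          ∎
  where open ℚ.≤-Reasoning

≤U-propagate : ∀ {l m x y} → l ≤ ¾ → x ≤ y → l * x + m ≤ U x → l * y + m ≤ U y
≤U-propagate {l} {m} {x} {y} l≤¾ x≤y ≤Ux = begin
  l * y + m                          ≡⟨ solve 4 (λ l m x y → l :* y :+ m := (l :* x :+ m) :+ l :* (y :- x)) refl l m x y ⟩
  (l * x + m) + l * (y - x)          ≤⟨ ℚ.+-mono-≤ ≤Ux (ℚ.*-monoʳ-≤-nonNeg (y - x) {{ℚ.nonNegative (p≤q⇒0≤q-p x≤y)}} l≤¾) ⟩
  U x + ¾ * (y - x)                  ≡⟨ solve 2 (λ x y → (con ¾ :* x :- con ¾) :+ con ¾ :* (y :- x) := con ¾ :* y :- con ¾) refl x y ⟩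
  U y                                ∎
  where open ℚ.≤-Reasoning

x*¼<L[x] : ∀ x → x * ¼ < L x
x*¼<L[x] x = begin-strict
  x * ¼         ≡⟨ ℚ.+-identityʳ (x * ¼) ⟨
  x * ¼ + 0ℚ    <⟨ ℚ.+-monoʳ-< (x * ¼) (ℚ.positive⁻¹ ¾) ⟩
  L x           ∎
  where open ℚ.≤-Reasoning

U[x]<¾*x : ∀ x → U x < ¾ * x
U[x]<¾*x x = begin-strict
  U x           <⟨ ℚ.+-monoʳ-< (¾ * x) (ℚ.negative⁻¹ (ℚ.- ¾)) ⟩
  ¾ * x + 0ℚ    ≡⟨ ℚ.+-identityʳ (¾ * x) ⟩
  ¾ * x         ∎
  where open ℚ.≤-Reasoning

L[x]≤a⇒0<4a-x : ∀ {x a} → L x ≤ a → 0ℚ < ⟦ 4 ⟧ * a - x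
L[x]≤a⇒0<4a-x {x} {a} Lx≤a = begin-strict
  0ℚ                     <⟨ ℚ.positive⁻¹ ⟦ 3 ⟧ ⟩
  ⟦ 3 ⟧                  ≡⟨ solve 1 (λ x → con ⟦ 3 ⟧ := con ⟦ 4 ⟧ :* (x :* con ¼ :+ con ¾) :- x) refl x ⟩
  ⟦ 4 ⟧ * L x - x        ≤⟨ ℚ.+-monoˡ-≤ (ℚ.- x) (ℚ.*-monoˡ-≤-nonNeg ⟦ 4 ⟧ Lx≤a) ⟩
  ⟦ 4 ⟧ * a - x          ∎
  where open ℚ.≤-Reasoning

4*α*s*r≡4*[α*s*r] : ∀ α r s → 4 ℕ.* α ℕ.* s ℕ.* r ≡ 4 ℕ.* (α ℕ.* s ℕ.* r)
4*α*s*r≡4*[α*s*r] α r s = trans (cong (ℕ._* r) (ℕ.*-assoc 4 α s)) (ℕ.*-assoc 4 (α ℕ.* s) r)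

α*s*r-nonZero : ∀ α r s → .{{NonZero α}} → .{{NonZero r}} → .{{NonZero s}} → NonZero (α ℕ.* s ℕ.* r)
α*s*r-nonZero α r s = ℕ.m*n≢0 (α ℕ.* s) r {{ℕ.m*n≢0 α s}}

lam≡slope : ∀ α r s → lam α r s ≡ slope ⟦ α ℕ.* s ℕ.* r ⟧
lam≡slope α r s = cong (λ d → ⟦ α ℕ.* s ℕ.* r ⟧ ÷′ (d - 1ℚ))
  (trans (cong ⟦_⟧ (4*α*s*r≡4*[α*s*r] α r s)) (⟦⟧-homo-* 4 (α ℕ.* s ℕ.* r)))

lam-bounds : ∀ α r s → .{{NonZero α}} → .{{NonZero r}} → .{{NonZero s}} → ¼ ≤ lam α r s × lam α r s ≤ ¾
lam-bounds α r s = subst (λ l → ¼ ≤ l × l ≤ ¾) (sym (lam≡slope α r s)) (¼≤slope 1≤b , slope≤¾ 1≤b)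
  where
  1≤b : 1ℚ ≤ ⟦ α ℕ.* s ℕ.* r ⟧
  1≤b = ⟦⟧-mono-≤ (ℕ.>-nonZero⁻¹ _ {{α*s*r-nonZero α r s}})

4*n∸1-nonZero : ∀ n → .{{NonZero n}} → NonZero (4 ℕ.* n ℕ.∸ 1)
4*n∸1-nonZero (suc k) = subst (λ m → NonZero (m ℕ.∸ 1)) (sym (ℕ.*-suc 4 k)) _

Mod-nonZero : ∀ α r s → .{{NonZero α}} → .{{NonZero r}} → .{{NonZero s}} → NonZero (Mod α r s)
Mod-nonZero α r s rewrite 4*α*s*r≡4*[α*s*r] α r s = 4*n∸1-nonZero _ {{α*s*r-nonZero α r s}}

lcm-nonZero : ∀ m n → .{{NonZero m}} → .{{NonZero n}} → NonZero (lcm m n)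
lcm-nonZero m n = ℕ.≢-nonZero λ lcm≡0 → ℕ.≢-nonZero⁻¹ (m ℕ.* n) {{ℕ.m*n≢0 m n}}
  (0∣⇒≡0 (subst (_∣ m ℕ.* n) lcm≡0 (lcm-least (m∣m*n {m} n) (n∣m*n m))))

lcmFin-nonZero : ∀ K (f : Fin K → ℕ) → (∀ i → NonZero (f i)) → NonZero (lcmFin K f)
lcmFin-nonZero zero    f f≢0 = _
lcmFin-nonZero (suc K) f f≢0 = lcm-nonZero _ _ {{f≢0 zero}} {{lcmFin-nonZero K (f ∘ suc) (f≢0 ∘ suc)}}

f∣lcmFin : ∀ K (f : Fin K → ℕ) i → f i ∣ lcmFin K f
f∣lcmFin (suc K) f zero    = m∣lcm[m,n] _ _
f∣lcmFin (suc K) f (suc i) = ∣-trans (f∣lcmFin K (f ∘ suc) i) (n∣lcm[m,n] (f zero) _)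

≡-[mod]⇒∣+ : ∀ {M} p c → (+ p) ≡ ℤ.- (+ c) [mod M ] → M ∣ p ℕ.+ c
≡-[mod]⇒∣+ p c = subst (_ ∣_) (cong (λ z → ℤ.∣ + p ℤ.+ z ∣) (ℤ.neg-involutive (+ c)))

∣n%m+c⇒∣c+n : ∀ {d m} n c .{{_ : NonZero m}} → d ∣ m → d ∣ n % m ℕ.+ c → d ∣ c ℕ.+ n
∣n%m+c⇒∣c+n {d} {m} n c d∣m d∣n%m+c = subst (d ∣_) n%m+c+q*m≡c+n
  (∣m∣n⇒∣m+n d∣n%m+c (∣-trans d∣m (n∣m*n (n ℕ./ m))))
  where
  open ≡-Reasoning
  n%m+c+q*m≡c+n : n % m ℕ.+ c ℕ.+ (n ℕ./ m) ℕ.* m ≡ c ℕ.+ n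
  n%m+c+q*m≡c+n = begin
    n % m ℕ.+ c ℕ.+ (n ℕ./ m) ℕ.* m     ≡⟨ cong (ℕ._+ (n ℕ./ m) ℕ.* m) (ℕ.+-comm (n % m) c) ⟩
    c ℕ.+ n % m ℕ.+ (n ℕ./ m) ℕ.* m     ≡⟨ ℕ.+-assoc c (n % m) _ ⟩
    c ℕ.+ (n % m ℕ.+ (n ℕ./ m) ℕ.* m)   ≡⟨ cong (c ℕ.+_) (m≡m%n+[m/n]*n n m) ⟨
    c ℕ.+ n                           ∎

theoremD14 : (α : ℕ) → NonZero α →
    (K : ℕ) → (r s : Fin K → ℕ) →
    ((i : Fin K) → NonZero (r i)) → ((i : Fin K) → NonZero (s i)) →
    ((p : ℕ) → p ℕ.< lcmFin K (λ i → Mod α (r i) (s i)) →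
      Σ (Fin K) λ i →
        ((+ p) ≡ ℤ.- (+ (4 ℕ.* α ℕ.* (s i ℕ.* s i))) [mod Mod α (r i) (s i) ])
        × (L ⟦ p ⟧ ≤ A α (r i) (s i) ⟦ p ⟧)
        × (A α (r i) (s i) ⟦ p ⟧ ≤ U ⟦ p ⟧)) →
    (P : ℕ) → Prime P → ¬ (2 ∣ P) →
    Σ (Fin K) λ i →
      (Mod α (r i) (s i) ∣ (4 ℕ.* α ℕ.* (s i ℕ.* s i) ℕ.+ P))
      × (L ⟦ P ⟧ ≤ A α (r i) (s i) ⟦ P ⟧)
      × (A α (r i) (s i) ⟦ P ⟧ ≤ U ⟦ P ⟧)
      × (⟦ P ⟧ * (+ 1 / 4) < L ⟦ P ⟧)
      × (U ⟦ P ⟧ < (+ 3 / 4) * ⟦ P ⟧)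
      × (0ℚ < ⟦ 4 ⟧ * A α (r i) (s i) ⟦ P ⟧ - ⟦ P ⟧)
theoremD14 α α≢0 K r s r≢0 s≢0 covering P _ _ =
  let (i , p≡-c , L≤A[p] , A[p]≤U) = covering p (m%n<n P Q)
      (¼≤λ , λ≤¾) = lam-bounds α (r i) (s i) {{α≢0}} {{r≢0 i}} {{s≢0 i}}
      L≤A[P] = L≤-propagate ¼≤λ p≤P L≤A[p]
  in i
   , ∣n%m+c⇒∣c+n P _ (f∣lcmFin K M i) (≡-[mod]⇒∣+ p _ p≡-c)
   , L≤A[P]
   , ≤U-propagate λ≤¾ p≤P A[p]≤U
   , x*¼<L[x] ⟦ P ⟧
   , U[x]<¾*x ⟦ P ⟧
   , L[x]≤a⇒0<4a-x L≤A[P]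
  where
  M : Fin K → ℕ
  M i = Mod α (r i) (s i)
  Q : ℕ
  Q = lcmFin K M
  instance
    Q≢0 : NonZero Q
    Q≢0 = lcmFin-nonZero K M (λ i → Mod-nonZero α (r i) (s i) {{α≢0}} {{r≢0 i}} {{s≢0 i}})
  p : ℕ
  p = P % Q
  p≤P : ⟦ p ⟧ ≤ ⟦ P ⟧
  p≤P = ⟦⟧-mono-≤ (m%n≤m P Q)
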